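{- For every formula $\varphi\in\mathit{Fm}$, $\vdash_{\mathrm{HIPWK}}\varphi$ if and only if $\vdash_{\mathrm{IPC}}\varphi$.
   Context: Formulas $\mathit{Fm}$ are built over a countably infinite set $V$ of variables in the language $\{\land,\lor,\longrightarrow,\neg,0,1\}$. $\vdash_{\mathrm{IPC}}$ is intuitionistic propositional logic, which is the Hilbert-style logic with the axiom schemes (A1)–(A10) below and unrestricted modus ponens. HIPWK is the Hilbert-style logic with axiom schemes (A1) $\alpha\longrightarrow(\beta\longrightarrow\alpha)$; (A2) $(\alpha\longrightarrow(\beta\longrightarrow\gamma))\longrightarrow((\alpha\longrightarrow\beta)\longrightarrow(\alpha\longrightarrow\gamma))$; (A3) $\alpha\longrightarrow(\beta\longrightarrow(\alpha\land\beta))$; (A4) $\alpha\land\beta\longrightarrow\alpha$; (A5) $\alpha\land\beta\longrightarrow\beta$; (A6) $\alpha\longrightarrow\alpha\lor\beta$; (A7) $\beta\longrightarrow\alpha\lor\beta$; (A8) $(\alpha\longrightarrow\gamma)\longrightarrow((\beta\longrightarrow\gamma)\longrightarrow(\alpha\lor\beta\longrightarrow\gamma))$; (A9) $(\alpha\longrightarrow\beta)\longrightarrow((\alpha\longrightarrow\neg\beta)\longrightarrow\neg\alpha)$; (A10) $0\longrightarrow\alpha$, and the single rule (restricted modus ponens) $\frac{\alpha,\ \alpha\longrightarrow\beta}{\beta}$ provided $\mathrm{var}(\alpha)\subseteq\mathrm{var}(\beta)$, where $\mathrm{var}(\varphi)$ is the set of variables occurring in $\varphi$. $\vdash\varphi$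 means $\varphi$ is derivable from no hypotheses. -}

module Defs where

open import Data.Nat using (ℕ)
open import Data.Product using (_×_)
open import Data.Sum using (_⊎_)
open import Relation.Binary.PropositionalEquality using (_≡_)

Var : Set
Var = ℕ

data Fm : Set where
  var  : Var → Fm
  _∧_  : Fm → Fm → Fm
  _∨_  : Fm → Fm → Fm
  _⇒_  : Fm → Fm → Fm
  ¬_   : Fm → Fm
  𝟘    : Fm
  𝟙    : Fm

infixr 5 _⇒_
infixr 6 _∨_
infixr 7 _∧_
infix 8 ¬_

data _∈var_ (x : Var) : Fm → Set where
  here  : x ∈var var x
  ∧ˡ : ∀ {a b} → x ∈var a → x ∈var (a ∧ b)
  ∧ʳ : ∀ {a b} → x ∈var b → x ∈var (a ∧ b)
  ∨ˡ : ∀ {a b} → x ∈var a → x ∈var (a ∨ b)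
  ∨ʳ : ∀ {a b} → x ∈var b → x ∈var (a ∨ b)
  ⇒ˡ : ∀ {a b} → x ∈var a → x ∈var (a ⇒ b)
  ⇒ʳ : ∀ {a b} → x ∈var b → x ∈var (a ⇒ b)
  ¬·  : ∀ {a} → x ∈var a → x ∈var (¬ a)

_⊆var_ : Fm → Fm → Set
α ⊆var β = ∀ x → x ∈var α → x ∈var β

data Axiom : Fm → Set where
  A1  : ∀ α β → Axiom (α ⇒ (β ⇒ α))
  A2  : ∀ α β γ → Axiom ((α ⇒ (β ⇒ γ)) ⇒ ((α ⇒ β) ⇒ (α ⇒ γ)))
  A3  : ∀ α β → Axiom (α ⇒ (β ⇒ (α ∧ β)))
  A4  : ∀ α β → Axiom (α ∧ β ⇒ α)
  A5  : ∀ α β → Axiom (α ∧ β ⇒ β)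
  A6  : ∀ α β → Axiom (α ⇒ α ∨ β)
  A7  : ∀ α β → Axiom (β ⇒ α ∨ β)
  A8  : ∀ α β γ → Axiom ((α ⇒ γ) ⇒ ((β ⇒ γ) ⇒ (α ∨ β ⇒ γ)))
  A9  : ∀ α β → Axiom ((α ⇒ β) ⇒ ((α ⇒ ¬ β) ⇒ ¬ α))
  A10 : ∀ α → Axiom (𝟘 ⇒ α)

data ⊢IPC_ : Fm → Set where
  ax : ∀ {φ} → Axiom φ → ⊢IPC φ
  mp : ∀ {α β} → ⊢IPC α → ⊢IPC (α ⇒ β) → ⊢IPC β

data ⊢HIPWK_ : Fm → Set where
  ax  : ∀ {φ} → Axiom φ → ⊢HIPWK φ
  rmp : ∀ {α β} → α ⊆var β → ⊢HIPWK α → ⊢HIPWK (α ⇒ β) → ⊢HIPWK β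

-- HIPWK is closed under substitution, and the restriction on modus ponens is
-- harmless: given α and α ⇒ β, substitute 𝟘 for every variable of α that does
-- not occur in β. This fixes β, and the instance of α only has variables of β,
-- so restricted modus ponens applies to the substituted premises.
module Submission where

open import Defs
open import Function.Base using (_∘_)
open import Function.Bundles using (_⇔_; mk⇔)
open import Data.Nat.Properties using (_≟_)
open import Data.Product using (∃; _×_; _,_; map₁; map₂)
open import Data.Sum using (inj₁; inj₂; [_,_]′)
open import Relation.Nullary using (yes; no; contradiction)
open import Relation.Nullary.Decidable using (Dec; map′; _⊎-dec_)
open import Relation.Binary.PropositionalEquality using (_≡_; refl; cong; cong₂; subst; sym)

Subst : Set
Subst = Var → Fm

sub : Subst → Fm → Fm
sub σ (var x) = σ x
sub σ (a ∧ b) = sub σ a ∧ sub σ b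
sub σ (a ∨ b) = sub σ a ∨ sub σ b
sub σ (a ⇒ b) = sub σ a ⇒ sub σ b
sub σ (¬ a)   = ¬ sub σ a
sub σ 𝟘       = 𝟘
sub σ 𝟙       = 𝟙

Axiom-sub : ∀ σ {φ} → Axiom φ → Axiom (sub σ φ)
Axiom-sub σ (A1 α β)   = A1 _ _
Axiom-sub σ (A2 α β γ) = A2 _ _ _
Axiom-sub σ (A3 α β)   = A3 _ _
Axiom-sub σ (A4 α β)   = A4 _ _
Axiom-sub σ (A5 α β)   = A5 _ _
Axiom-sub σ (A6 α β)   = A6 _ _
Axiom-sub σ (A7 α β)   = A7 _ _
Axiom-sub σ (A8 α β γ) = A8 _ _ _
Axiom-sub σ (A9 α β)   = A9 _ _
Axiom-sub σ (A10 α)    = A10 _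

∈var-sub⁻ : ∀ σ α {x} → x ∈var sub σ α → ∃ λ y → y ∈var α × x ∈var σ y
∈var-sub⁻ σ (var y) p      = y , here , p
∈var-sub⁻ σ (a ∧ b) (∧ˡ p) = map₂ (map₁ ∧ˡ) (∈var-sub⁻ σ a p)
∈var-sub⁻ σ (a ∧ b) (∧ʳ p) = map₂ (map₁ ∧ʳ) (∈var-sub⁻ σ b p)
∈var-sub⁻ σ (a ∨ b) (∨ˡ p) = map₂ (map₁ ∨ˡ) (∈var-sub⁻ σ a p)
∈var-sub⁻ σ (a ∨ b) (∨ʳ p) = map₂ (map₁ ∨ʳ) (∈var-sub⁻ σ b p)
∈var-sub⁻ σ (a ⇒ b) (⇒ˡ p) = map₂ (map₁ ⇒ˡ) (∈var-sub⁻ σ a p)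
∈var-sub⁻ σ (a ⇒ b) (⇒ʳ p) = map₂ (map₁ ⇒ʳ) (∈var-sub⁻ σ b p)
∈var-sub⁻ σ (¬ a)   (¬· p) = map₂ (map₁ ¬·) (∈var-sub⁻ σ a p)

∈var-sub⁺ : ∀ σ {β x y} → y ∈var β → x ∈var σ y → x ∈var sub σ β
∈var-sub⁺ σ here   r = r
∈var-sub⁺ σ (∧ˡ p) r = ∧ˡ (∈var-sub⁺ σ p r)
∈var-sub⁺ σ (∧ʳ p) r = ∧ʳ (∈var-sub⁺ σ p r)
∈var-sub⁺ σ (∨ˡ p) r = ∨ˡ (∈var-sub⁺ σ p r)
∈var-sub⁺ σ (∨ʳ p) r = ∨ʳ (∈var-sub⁺ σ p r)
∈var-sub⁺ σ (⇒ˡ p) r = ⇒ˡ (∈var-sub⁺ σ p r)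
∈var-sub⁺ σ (⇒ʳ p) r = ⇒ʳ (∈var-sub⁺ σ p r)
∈var-sub⁺ σ (¬· p) r = ¬· (∈var-sub⁺ σ p r)

⊆var-sub : ∀ σ {α β} → α ⊆var β → sub σ α ⊆var sub σ β
⊆var-sub σ {α} α⊆β x p with ∈var-sub⁻ σ α p
... | y , y∈α , x∈σy = ∈var-sub⁺ σ (α⊆β y y∈α) x∈σy

⊢HIPWK-sub : ∀ σ {φ} → ⊢HIPWK φ → ⊢HIPWK sub σ φ
⊢HIPWK-sub σ (ax a)         = ax (Axiom-sub σ a)
⊢HIPWK-sub σ (rmp α⊆β d e) = rmp (⊆var-sub σ α⊆β) (⊢HIPWK-sub σ d) (⊢HIPWK-sub σ e)

sub-id : ∀ σ φ → (∀ {x} → x ∈var φ → σ x ≡ var x) → sub σ φ ≡ φ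
sub-id σ (var x) h = h here
sub-id σ (a ∧ b) h = cong₂ _∧_ (sub-id σ a (h ∘ ∧ˡ)) (sub-id σ b (h ∘ ∧ʳ))
sub-id σ (a ∨ b) h = cong₂ _∨_ (sub-id σ a (h ∘ ∨ˡ)) (sub-id σ b (h ∘ ∨ʳ))
sub-id σ (a ⇒ b) h = cong₂ _⇒_ (sub-id σ a (h ∘ ⇒ˡ)) (sub-id σ b (h ∘ ⇒ʳ))
sub-id σ (¬ a)   h = cong ¬_ (sub-id σ a (h ∘ ¬·))
sub-id σ 𝟘       h = refl
sub-id σ 𝟙       h = refl

_∈var?_ : ∀ x φ → Dec (x ∈var φ)
x ∈var? var y = map′ (λ { refl → here }) (λ { here → refl }) (x ≟ y)
x ∈var? (a ∧ b) = map′ [ ∧ˡ , ∧ʳ ]′ (λ { (∧ˡ p) → inj₁ p ; (∧ʳ p) → inj₂ p }) (x ∈var? a ⊎-dec x ∈var? b)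
x ∈var? (a ∨ b) = map′ [ ∨ˡ , ∨ʳ ]′ (λ { (∨ˡ p) → inj₁ p ; (∨ʳ p) → inj₂ p }) (x ∈var? a ⊎-dec x ∈var? b)
x ∈var? (a ⇒ b) = map′ [ ⇒ˡ , ⇒ʳ ]′ (λ { (⇒ˡ p) → inj₁ p ; (⇒ʳ p) → inj₂ p }) (x ∈var? a ⊎-dec x ∈var? b)
x ∈var? (¬ a)   = map′ ¬· (λ { (¬· p) → p }) (x ∈var? a)
x ∈var? 𝟘       = no λ ()
x ∈var? 𝟙       = no λ ()

zeroOutside : Fm → Subst
zeroOutside β y with y ∈var? β
... | yes _ = var y
... | no _  = 𝟘

zeroOutside-id : ∀ β {x} → x ∈var β → zeroOutside β x ≡ var x
zeroOutside-id β {x} x∈β with x ∈var? β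
... | yes _ = refl
... | no x∉β = contradiction x∈β x∉β

∈var-zeroOutside : ∀ β {x} y → x ∈var zeroOutside β y → x ∈var β
∈var-zeroOutside β y p with y ∈var? β
∈var-zeroOutside β y here | yes y∈β = y∈β

sub-zeroOutside-fixes : ∀ β → sub (zeroOutside β) β ≡ β
sub-zeroOutside-fixes β = sub-id (zeroOutside β) β (zeroOutside-id β)

sub-zeroOutside-⊆var : ∀ α β → sub (zeroOutside β) α ⊆var β
sub-zeroOutside-⊆var α β x p with ∈var-sub⁻ (zeroOutside β) α p
... | y , _ , x∈σy = ∈var-zeroOutside β y x∈σy

⊢HIPWK-mp : ∀ {α β} → ⊢HIPWK α → ⊢HIPWK (α ⇒ β) → ⊢HIPWK β
⊢HIPWK-mp {α} {β} d e =
  subst ⊢HIPWK_ fixes (rmp α′⊆β′ (⊢HIPWK-sub σ d) (⊢HIPWK-sub σ e))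
  where
  σ = zeroOutside β
  fixes = sub-zeroOutside-fixes β
  α′⊆β′ : sub σ α ⊆var sub σ β
  α′⊆β′ = subst (sub σ α ⊆var_) (sym fixes) (sub-zeroOutside-⊆var α β)

⊢HIPWK⇒⊢IPC : ∀ {φ} → ⊢HIPWK φ → ⊢IPC φ
⊢HIPWK⇒⊢IPC (ax a)      = ax a
⊢HIPWK⇒⊢IPC (rmp _ d e) = mp (⊢HIPWK⇒⊢IPC d) (⊢HIPWK⇒⊢IPC e)

⊢IPC⇒⊢HIPWK : ∀ {φ} → ⊢IPC φ → ⊢HIPWK φ
⊢IPC⇒⊢HIPWK (ax a)   = ax a
⊢IPC⇒⊢HIPWK (mp d e) = ⊢HIPWK-mp (⊢IPC⇒⊢HIPWK d) (⊢IPC⇒⊢HIPWK e)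

theorem4p10 : (φ : Fm) → (⊢HIPWK φ) ⇔ (⊢IPC φ)
theorem4p10 φ = mk⇔ ⊢HIPWK⇒⊢IPC ⊢IPC⇒⊢HIPWK
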